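{- Let $k\geq1$ and let $C_1(k)>0$ be a constant such that for every sufficiently large $n$ and every partition $\{1,\ldots,n\}=A_1\cup\cdots\cup A_k$ one has $\sum_{i=1}^k|\{(x,y,z):x,y,z\in A_i,\ x+y=z\}|\geq C_1(k)n^2$. Let $A\subseteq\{1,\ldots,n\}$ with $|A|\geq(1-C_1(k)/6)n$, and suppose $A=A_1\cup\cdots\cup A_k$ is a partition of $A$. Then, provided $n$ is sufficiently large, $$\sum_{i=1}^k|\{(x,y,z):\ x,y,z\in A_i,\ x+y=z\}|\geq\frac{C_1(k)}{2}n^2.$$
   Context: Triples $(x,y,z)$ are ordered triples of positive integers. -}

module Defs where

open import Data.Nat using (ℕ; suc; _+_; _≤ᵇ_)
open import Data.Bool using (Bool; true; false; _∧_; if_then_else_)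
open import Data.Fin using (Fin)
import Data.Fin as F
open import Data.List using (List; map; upTo)
open import Data.Nat.ListAction using (sum)
open import Data.Integer using (+_)
open import Data.Rational using (ℚ; _/_; _<_; _≤_)
open import Data.Product using (∃; _×_)
open import Relation.Nullary using (¬_)
open import Relation.Nullary.Decidable using (isYes)

range : ℕ → List ℕ
range n = map suc (upTo n)

ℕ→ℚ : ℕ → ℚ
ℕ→ℚ n = + n / 1

card : ℕ → (ℕ → Bool) → ℕ
card n inA = sum (map (λ x → if inA x then 1 else 0) (range n))

-- Given A ⊆ {1..n} (indicator inA) and the partition A = A_1 ∪ ... ∪ A_k given
-- by a colouring col (A_i = {x ∈ A | col x = i}), this is
--   Σ_i |{(x,y,z) : x,y,z ∈ A_i, x + y = z}|
-- (z = x + y is determined by (x,y); the constraint z ∈ {1..n} is x + y ≤ n).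
schurCount : ∀ {k} → ℕ → (ℕ → Bool) → (ℕ → Fin k) → ℕ
schurCount n inA col =
  sum (map (λ x → sum (map (λ y →
    if (x + y ≤ᵇ n) ∧ inA x ∧ inA y ∧ inA (x + y)
       ∧ isYes (col x F.≟ col y) ∧ isYes (col x F.≟ col (x + y))
    then 1 else 0) (range n))) (range n))

-- A real number c, represented by its (open) lower Dedekind cut
-- mem q  ⇔  q < c.
record Real : Set₁ where
  field
    mem       : ℚ → Set
    inhabited : ∃ λ q → mem q
    bounded   : ∃ λ q → ¬ mem q
    downward  : ∀ {p q} → p ≤ q → mem q → mem p
    open-up   : ∀ {q} → mem q → ∃ λ r → (q < r) × mem r
open Real public

Positive : Real → Set
Positive c = mem c (ℕ→ℚ 0)

{-# OPTIONS --safe #-}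
module Submission where

-- A monochromatic Schur triple of {1, …, n} that is not a triple of A has x, y or x + y outside A.
-- With m = n ∸ |A| missing elements, at most 3nm triples are lost: nm through x, nm through y,
-- and at most m for each fixed x through x + y. Hence 2·count(A) ≥ 2C₁n² − 6mn, and 6m ≤ C₁n
-- absorbs the loss. As C₁ is only known through its lower cut, the full-interval bound is applied
-- at the midpoint r of q and 6m/n, which lies below C₁ and satisfies 2rn² = qn² + 6mn.

module FiniteSums where

  open import Defs using (range)
  open import Data.Nat
  open import Data.Nat.Properties
  open import Data.List using (map; applyUpTo)
  open import Data.List.Properties using (map-upTo)
  open import Data.Nat.ListAction using (sum)
  open import Relation.Binary.PropositionalEquality
  open import Function using (_∘_)
  open import Data.Nat.Solver using (module +-*-Solver)
  open +-*-Solver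

  ∑ : ℕ → (ℕ → ℕ) → ℕ
  ∑ zero    f = 0
  ∑ (suc n) f = f 0 + ∑ n (f ∘ suc)

  syntax ∑ n (λ i → e) = ∑[ i < n ] e

  sum-map-applyUpTo : ∀ (f g : ℕ → ℕ) n → sum (map f (applyUpTo g n)) ≡ ∑[ i < n ] f (g i)
  sum-map-applyUpTo f g zero    = refl
  sum-map-applyUpTo f g (suc n) = cong (f (g 0) +_) (sum-map-applyUpTo f (g ∘ suc) n)

  sum-map-range : ∀ (f : ℕ → ℕ) n → sum (map f (range n)) ≡ ∑[ i < n ] f (suc i)
  sum-map-range f n = trans (cong (sum ∘ map f) (map-upTo suc n)) (sum-map-applyUpTo f suc n)

  ∑-cong : ∀ {f g} n → (∀ i → f i ≡ g i) → ∑ n f ≡ ∑ n g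
  ∑-cong zero    f≗g = refl
  ∑-cong (suc n) f≗g = cong₂ _+_ (f≗g 0) (∑-cong n (f≗g ∘ suc))

  ∑-mono-≤ : ∀ {f g} n → (∀ i → f i ≤ g i) → ∑ n f ≤ ∑ n g
  ∑-mono-≤ zero    f≤g = z≤n
  ∑-mono-≤ (suc n) f≤g = +-mono-≤ (f≤g 0) (∑-mono-≤ n (f≤g ∘ suc))

  ∑-distrib-+ : ∀ f g n → ∑[ i < n ] (f i + g i) ≡ ∑ n f + ∑ n g
  ∑-distrib-+ f g zero    = refl
  ∑-distrib-+ f g (suc n) rewrite ∑-distrib-+ (f ∘ suc) (g ∘ suc) n =
    solve 4 (λ a b c d → a :+ b :+ (c :+ d) := a :+ c :+ (b :+ d)) refl
      (f 0) (g 0) (∑ n (f ∘ suc)) (∑ n (g ∘ suc))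

  ∑-const : ∀ c n → ∑[ i < n ] c ≡ n * c
  ∑-const c zero    = refl
  ∑-const c (suc n) = cong (c +_) (∑-const c n)

  ∑-*-distribˡ : ∀ c f n → ∑[ i < n ] (c * f i) ≡ c * ∑ n f
  ∑-*-distribˡ c f zero    = sym (*-zeroʳ c)
  ∑-*-distribˡ c f (suc n) =
    trans (cong (c * f 0 +_) (∑-*-distribˡ c (f ∘ suc) n)) (sym (*-distribˡ-+ c (f 0) _))

  ∑-+ : ∀ f m n → ∑ (m + n) f ≡ ∑ m f + ∑[ i < n ] f (m + i)
  ∑-+ f zero    n = refl
  ∑-+ f (suc m) n = trans (cong (f 0 +_) (∑-+ (f ∘ suc) m n)) (sym (+-assoc (f 0) _ _))

  ∑-zero : ∀ {f} n → (∀ i → f i ≡ 0) → ∑ n f ≡ 0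
  ∑-zero n f≗0 = trans (∑-cong n f≗0) (trans (∑-const 0 n) (*-zeroʳ n))

  ∑-shift-≤ : ∀ {f} n a → (∀ i → f (n + i) ≡ 0) → ∑[ i < n ] f (a + i) ≤ ∑ n f
  ∑-shift-≤ {f} n a vanish = begin
    ∑[ i < n ] f (a + i)               ≤⟨ m≤n+m _ (∑ a f) ⟩
    ∑ a f + ∑[ i < n ] f (a + i)       ≡⟨ sym (∑-+ f a n) ⟩
    ∑ (a + n) f                        ≡⟨ cong (λ m → ∑ m f) (+-comm a n) ⟩
    ∑ (n + a) f                        ≡⟨ ∑-+ f n a ⟩
    ∑ n f + ∑[ i < a ] f (n + i)       ≡⟨ cong (∑ n f +_) (∑-zero a vanish) ⟩
    ∑ n f + 0                          ≡⟨ +-identityʳ _ ⟩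
    ∑ n f                              ∎
    where open ≤-Reasoning

module SchurTripleCount where

  open import Defs using (card; schurCount)
  open import Data.Nat
  open import Data.Nat.Properties
  open import Data.Bool using (Bool; true; false; not; _∧_; if_then_else_)
  open import Data.Fin using (Fin)
  import Data.Fin as Fin
  open import Relation.Nullary.Decidable using (isYes)
  open import Relation.Binary.PropositionalEquality
  open import Function using (_∘_)
  open import Data.Nat.Solver using (module +-*-Solver)
  open +-*-Solver
  open FiniteSums

  indicator : Bool → ℕ
  indicator b = if b then 1 else 0

  indicator-+-not : ∀ b → indicator b + indicator (not b) ≡ 1
  indicator-+-not false = refl
  indicator-+-not true  = refl

  indicator-∧-≤ʳ : ∀ a b → indicator (a ∧ b) ≤ indicator b
  indicator-∧-≤ʳ false b = z≤n
  indicator-∧-≤ʳ true  b = ≤-refl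

  -- A triple of the full interval survives in A unless one of x, y, x + y is missing from A.
  indicator-triple-≤ : ∀ b ax ay az c → indicator (b ∧ true ∧ true ∧ true ∧ c)
    ≤ indicator (b ∧ ax ∧ ay ∧ az ∧ c) + indicator (not ax) + indicator (not ay) + indicator (b ∧ not az)
  indicator-triple-≤ false ax    ay    az    c     = z≤n
  indicator-triple-≤ true  ax    ay    az    false = z≤n
  indicator-triple-≤ true  false ay    az    true  = s≤s z≤n
  indicator-triple-≤ true  true  false az    true  = s≤s z≤n
  indicator-triple-≤ true  true  true  false true  = s≤s z≤n
  indicator-triple-≤ true  true  true  true  true  = s≤s z≤n

  suc-+-≤ᵇ : ∀ n i → (suc (n + i) ≤ᵇ n) ≡ false
  suc-+-≤ᵇ zero    i = refl
  suc-+-≤ᵇ (suc n) i = suc-+-≤ᵇ n i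

  module _ (n : ℕ) (inA : ℕ → Bool) {k} (col : ℕ → Fin k) where

    private
      monochromatic : ℕ → ℕ → Bool
      monochromatic x y = isYes (col x Fin.≟ col y) ∧ isYes (col x Fin.≟ col (x + y))

      triple : (ℕ → Bool) → ℕ → ℕ → ℕ
      triple B x y = indicator ((x + y ≤ᵇ n) ∧ B x ∧ B y ∧ B (x + y) ∧ monochromatic x y)

      schurCount≡∑∑ : ∀ B → schurCount n B col ≡ ∑[ i < n ] ∑[ j < n ] triple B (suc i) (suc j)
      schurCount≡∑∑ B = trans (sum-map-range _ n) (∑-cong n (λ i → sum-map-range _ n))

      missing : ℕ → ℕ
      missing z = indicator (not (inA z))

      missingBelow : ℕ → ℕ
      missingBelow z = indicator ((z ≤ᵇ n) ∧ not (inA z))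

      deficit : ℕ
      deficit = ∑[ i < n ] missing (suc i)

      ∑-missingBelow-≤ : ∀ i → ∑[ j < n ] missingBelow (suc i + suc j) ≤ deficit
      ∑-missingBelow-≤ i = begin
        ∑[ j < n ] missingBelow (suc i + suc j)   ≡⟨ ∑-cong n (λ j → cong (missingBelow ∘ suc) (+-suc i j)) ⟩
        ∑[ j < n ] missingBelow (suc (suc i + j)) ≤⟨ ∑-shift-≤ n (suc i) vanish ⟩
        ∑[ j < n ] missingBelow (suc j)           ≤⟨ ∑-mono-≤ n (λ j → indicator-∧-≤ʳ (suc j ≤ᵇ n) _) ⟩
        deficit                                   ∎
        where
        open ≤-Reasoning
        vanish : ∀ j → missingBelow (suc (n + j)) ≡ 0
        vanish j rewrite suc-+-≤ᵇ n j = refl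

      row-≤ : ∀ i → ∑[ j < n ] triple (λ _ → true) (suc i) (suc j)
        ≤ ∑[ j < n ] triple inA (suc i) (suc j) + n * missing (suc i) + deficit + deficit
      row-≤ i = begin
        ∑[ j < n ] triple (λ _ → true) x (suc j)
          ≤⟨ ∑-mono-≤ n (λ j → indicator-triple-≤ (x + suc j ≤ᵇ n)
               (inA x) (inA (suc j)) (inA (x + suc j)) (monochromatic x (suc j))) ⟩
        ∑[ j < n ] (t j + missing x + missing (suc j) + h j)
          ≡⟨ ∑-distrib-+ (λ j → t j + missing x + missing (suc j)) h n ⟩
        ∑[ j < n ] (t j + missing x + missing (suc j)) + ∑ n h
          ≡⟨ cong (_+ ∑ n h) (∑-distrib-+ (λ j → t j + missing x) (missing ∘ suc) n) ⟩
        ∑[ j < n ] (t j + missing x) + deficit + ∑ n h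
          ≡⟨ cong (λ s → s + deficit + ∑ n h) (∑-distrib-+ t (λ _ → missing x) n) ⟩
        ∑ n t + ∑[ j < n ] missing x + deficit + ∑ n h
          ≡⟨ cong (λ s → ∑ n t + s + deficit + ∑ n h) (∑-const (missing x) n) ⟩
        ∑ n t + n * missing x + deficit + ∑ n h
          ≤⟨ +-monoʳ-≤ (∑ n t + n * missing x + deficit) (∑-missingBelow-≤ i) ⟩
        ∑ n t + n * missing x + deficit + deficit
          ∎
        where
        open ≤-Reasoning
        x : ℕ
        x = suc i
        t h : ℕ → ℕ
        t j = triple inA x (suc j)
        h j = missingBelow (x + suc j)

      card+deficit≡n : card n inA + deficit ≡ n
      card+deficit≡n = begin
        card n inA + deficit                                  ≡⟨ cong (_+ deficit) (sum-map-range _ n) ⟩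
        ∑[ i < n ] indicator (inA (suc i)) + deficit          ≡⟨ sym (∑-distrib-+ _ _ n) ⟩
        ∑[ i < n ] (indicator (inA (suc i)) + missing (suc i)) ≡⟨ ∑-cong n (λ i → indicator-+-not (inA (suc i))) ⟩
        ∑[ i < n ] 1                                          ≡⟨ ∑-const 1 n ⟩
        n * 1                                                 ≡⟨ *-identityʳ n ⟩
        n                                                     ∎
        where open ≡-Reasoning

      n∸card≡deficit : n ∸ card n inA ≡ deficit
      n∸card≡deficit = trans (cong (_∸ card n inA) (sym card+deficit≡n)) (m+n∸m≡n (card n inA) deficit)

    schurCount-all-≤ : schurCount n (λ _ → true) col ≤ schurCount n inA col + 3 * (n * (n ∸ card n inA))
    schurCount-all-≤ = begin
      schurCount n (λ _ → true) col
        ≡⟨ schurCount≡∑∑ (λ _ → true) ⟩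
      ∑[ i < n ] ∑[ j < n ] triple (λ _ → true) (suc i) (suc j)
        ≤⟨ ∑-mono-≤ n row-≤ ⟩
      ∑[ i < n ] (P i + n * missing (suc i) + deficit + deficit)
        ≡⟨ ∑-distrib-+ _ _ n ⟩
      ∑[ i < n ] (P i + n * missing (suc i) + deficit) + ∑[ i < n ] deficit
        ≡⟨ cong₂ _+_ (∑-distrib-+ _ _ n) (∑-const deficit n) ⟩
      ∑[ i < n ] (P i + n * missing (suc i)) + ∑[ i < n ] deficit + n * deficit
        ≡⟨ cong₂ (λ s t → s + t + n * deficit) (∑-distrib-+ _ _ n) (∑-const deficit n) ⟩
      ∑ n P + ∑[ i < n ] (n * missing (suc i)) + n * deficit + n * deficit
        ≡⟨ cong₂ (λ s t → s + t + n * deficit + n * deficit) (sym (schurCount≡∑∑ inA)) (∑-*-distribˡ n _ n) ⟩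
      schurCount n inA col + n * deficit + n * deficit + n * deficit
        ≡⟨ solve 2 (λ S d → S :+ d :+ d :+ d := S :+ con 3 :* d) refl (schurCount n inA col) (n * deficit) ⟩
      schurCount n inA col + 3 * (n * deficit)
        ≡⟨ cong (λ d → schurCount n inA col + 3 * (n * d)) (sym n∸card≡deficit) ⟩
      schurCount n inA col + 3 * (n * (n ∸ card n inA))
        ∎
      where
      open ≤-Reasoning
      P : ℕ → ℕ
      P i = ∑[ j < n ] triple inA (suc i) (suc j)

module NaturalsInRationals where

  open import Defs using (ℕ→ℚ)
  open import Data.Nat as ℕ using (ℕ; suc)
  open import Data.Integer as ℤ using (+_)
  import Data.Integer.Properties as ℤ
  open import Data.Rational
  open import Data.Rational.Properties
  import Data.Rational.Unnormalised as ℚᵘ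
  import Data.Rational.Unnormalised.Properties as ℚᵘ
  open import Data.Nat.Coprimality using (1-coprimeTo; sym)
  open import Relation.Binary.PropositionalEquality as ≡ using (_≡_; cong; cong₂)

  ℕ→ℚ-normal : ∀ n → ℕ→ℚ n ≡ mkℚ (+ n) 0 (sym (1-coprimeTo n))
  ℕ→ℚ-normal n = normalize-coprime (sym (1-coprimeTo n))

  toℚᵘ-ℕ→ℚ : ∀ n → toℚᵘ (ℕ→ℚ n) ≡ ℚᵘ.mkℚᵘ (+ n) 0
  toℚᵘ-ℕ→ℚ n = cong toℚᵘ (ℕ→ℚ-normal n)

  ℕ→ℚ-homo-+ : ∀ m n → ℕ→ℚ (m ℕ.+ n) ≡ ℕ→ℚ m + ℕ→ℚ n
  ℕ→ℚ-homo-+ m n = toℚᵘ-injective (begin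
    toℚᵘ (ℕ→ℚ (m ℕ.+ n))                ≡⟨ toℚᵘ-ℕ→ℚ (m ℕ.+ n) ⟩
    ℚᵘ.mkℚᵘ (+ (m ℕ.+ n)) 0             ≈⟨ ℚᵘ.*≡* (cong (ℤ._* + 1) (≡.sym (cong₂ ℤ._+_ (ℤ.*-identityʳ (+ m)) (ℤ.*-identityʳ (+ n))))) ⟩
    ℚᵘ.mkℚᵘ (+ m) 0 ℚᵘ.+ ℚᵘ.mkℚᵘ (+ n) 0 ≡⟨ ≡.sym (cong₂ ℚᵘ._+_ (toℚᵘ-ℕ→ℚ m) (toℚᵘ-ℕ→ℚ n)) ⟩
    toℚᵘ (ℕ→ℚ m) ℚᵘ.+ toℚᵘ (ℕ→ℚ n)     ≈⟨ ℚᵘ.≃-sym (toℚᵘ-homo-+ (ℕ→ℚ m) (ℕ→ℚ n)) ⟩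
    toℚᵘ (ℕ→ℚ m + ℕ→ℚ n)               ∎)
    where open ℚᵘ.≃-Reasoning

  ℕ→ℚ-homo-* : ∀ m n → ℕ→ℚ (m ℕ.* n) ≡ ℕ→ℚ m * ℕ→ℚ n
  ℕ→ℚ-homo-* m n = toℚᵘ-injective (begin
    toℚᵘ (ℕ→ℚ (m ℕ.* n))                ≡⟨ toℚᵘ-ℕ→ℚ (m ℕ.* n) ⟩
    ℚᵘ.mkℚᵘ (+ (m ℕ.* n)) 0             ≈⟨ ℚᵘ.*≡* (cong (ℤ._* + 1) (ℤ.pos-* m n)) ⟩
    ℚᵘ.mkℚᵘ (+ m) 0 ℚᵘ.* ℚᵘ.mkℚᵘ (+ n) 0 ≡⟨ ≡.sym (cong₂ ℚᵘ._*_ (toℚᵘ-ℕ→ℚ m) (toℚᵘ-ℕ→ℚ n)) ⟩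
    toℚᵘ (ℕ→ℚ m) ℚᵘ.* toℚᵘ (ℕ→ℚ n)     ≈⟨ ℚᵘ.≃-sym (toℚᵘ-homo-* (ℕ→ℚ m) (ℕ→ℚ n)) ⟩
    toℚᵘ (ℕ→ℚ m * ℕ→ℚ n)               ∎)
    where open ℚᵘ.≃-Reasoning

  ℕ→ℚ-mono-≤ : ∀ {m n} → m ℕ.≤ n → ℕ→ℚ m ≤ ℕ→ℚ n
  ℕ→ℚ-mono-≤ {m} {n} m≤n rewrite ℕ→ℚ-normal m | ℕ→ℚ-normal n =
    *≤* (≡.subst₂ ℤ._≤_ (≡.sym (ℤ.*-identityʳ (+ m))) (≡.sym (ℤ.*-identityʳ (+ n))) (ℤ.+≤+ m≤n))

  ℕ→ℚ-suc-pos : ∀ n → Positive (ℕ→ℚ (suc n))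
  ℕ→ℚ-suc-pos n = normalize-pos (suc n) 1

module LowerCuts where

  open import Defs using (Real; mem; downward)
  open import Data.Rational
  open import Data.Rational.Properties
  open import Relation.Binary.PropositionalEquality
  open import Relation.Nullary using (yes; no)
  open import Data.Rational.Solver using (module +-*-Solver)
  open +-*-Solver

  +-cancelʳ-≤ : ∀ r {p q} → p + r ≤ q + r → p ≤ q
  +-cancelʳ-≤ r {p} {q} le = subst₂ _≤_ (cancel p) (cancel q) (+-monoˡ-≤ (- r) le)
    where
    cancel : ∀ x → x + r + - r ≡ x
    cancel x = solve 2 (λ x r → x :+ r :+ :- r := x) refl x r

  *½+*½ : ∀ p → p * ½ + p * ½ ≡ p
  *½+*½ p = begin
    p * ½ + p * ½ ≡⟨ sym (*-distribˡ-+ p ½ ½) ⟩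
    p * 1ℚ        ≡⟨ *-identityʳ p ⟩
    p             ∎
    where open ≡-Reasoning

  midpoint<right : ∀ {p q} → p < q → (p + q) * ½ < q
  midpoint<right {p} {q} p<q = begin-strict
    (p + q) * ½   ≡⟨ *-distribʳ-+ ½ p q ⟩
    p * ½ + q * ½ <⟨ +-monoˡ-< (q * ½) (*-monoˡ-<-pos ½ p<q) ⟩
    q * ½ + q * ½ ≡⟨ *½+*½ q ⟩
    q             ∎
    where open ≤-Reasoning

  midpoint≤left : ∀ {p q} → q ≤ p → (p + q) * ½ ≤ p
  midpoint≤left {p} {q} q≤p = begin
    (p + q) * ½   ≡⟨ *-distribʳ-+ ½ p q ⟩
    p * ½ + q * ½ ≤⟨ +-monoʳ-≤ (p * ½) (*-monoʳ-≤-nonNeg ½ q≤p) ⟩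
    p * ½ + p * ½ ≡⟨ *½+*½ p ⟩
    p             ∎
    where open ≤-Reasoning

  module _ (C : Real) where

    mem-midpoint : ∀ {q w} → (∀ r → r < w → mem C r) → mem C q → mem C ((q + w) * ½)
    mem-midpoint {q} {w} below q∈C with q <? w
    ... | yes q<w = below _ (midpoint<right q<w)
    ... | no  q≮w = downward C (midpoint≤left (≮⇒≥ q≮w)) q∈C

    cut-bound : ∀ {w M F T} → (∀ r → r < w → mem C r) → (∀ r → mem C r → r * M ≤ F)
      → F + F ≤ T + w * M → ∀ q → mem C q → q * M ≤ T
    cut-bound {w} {M} {F} {T} below bounded budget q q∈C = +-cancelʳ-≤ (w * M) (begin
      q * M + w * M ≡⟨ sym (*-distribʳ-+ M q w) ⟩
      (q + w) * M   ≡⟨ cong (_* M) (sym (*½+*½ (q + w))) ⟩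
      (r + r) * M   ≡⟨ *-distribʳ-+ M r r ⟩
      r * M + r * M ≤⟨ +-mono-≤ (bounded r r∈C) (bounded r r∈C) ⟩
      F + F         ≤⟨ budget ⟩
      T + w * M     ∎)
      where
      open ≤-Reasoning
      r : ℚ
      r = (q + w) * ½
      r∈C : mem C r
      r∈C = mem-midpoint below q∈C

    scaled-cut-bound : ∀ {N W F T} .{{_ : Positive N}} → (∀ r → r * N < W → mem C r)
      → (∀ r → mem C r → r * (N * N) ≤ F) → F + F ≤ T + W * N
      → ∀ q → mem C q → q * (N * N) ≤ T
    scaled-cut-bound {N} {W} {F} {T} below bounded budget =
      cut-bound below′ bounded (subst (λ x → F + F ≤ T + x) W*N≡w*[N*N] budget)
      where
      instance
        N≢0 : NonZero N
        N≢0 = pos⇒nonZero N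
      w : ℚ
      w = W * 1/ N
      w*N≡W : w * N ≡ W
      w*N≡W = begin
        W * 1/ N * N   ≡⟨ *-assoc W (1/ N) N ⟩
        W * (1/ N * N) ≡⟨ cong (W *_) (*-inverseˡ N) ⟩
        W * 1ℚ         ≡⟨ *-identityʳ W ⟩
        W              ∎
        where open ≡-Reasoning
      below′ : ∀ r → r < w → mem C r
      below′ r r<w = below r (subst (r * N <_) w*N≡W (*-monoˡ-<-pos N r<w))
      W*N≡w*[N*N] : W * N ≡ w * (N * N)
      W*N≡w*[N*N] = trans (cong (_* N) (sym w*N≡W)) (*-assoc w N N)

open import Defs
open import Data.Nat using (ℕ; _≥_; _∸_)
open import Data.Bool using (Bool; true)
open import Data.Fin using (Fin)
open import Data.Product using (∃)
open import Data.Rational using (ℚ; _*_; _<_; _≤_)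

open import Data.Nat as ℕ using (zero; suc)
open import Data.Rational using (_+_)
open import Data.Nat.Solver using (module +-*-Solver)
import Data.Nat.Properties as ℕP
import Data.Rational.Properties as ℚP
open import Data.Product using (_,_)
open import Relation.Binary.PropositionalEquality using (_≡_; refl; sym; trans; cong; subst; subst₂)
open SchurTripleCount using (schurCount-all-≤)
open NaturalsInRationals
open LowerCuts using (scaled-cut-bound)

doubled-schurCount-all-≤ : ∀ n (inA : ℕ → Bool) {k} (col : ℕ → Fin k) →
  let F = schurCount n (λ _ → true) col in
  ℕ→ℚ F + ℕ→ℚ F
    ≤ ℕ→ℚ (2 ℕ.* schurCount n inA col) + ℕ→ℚ (6 ℕ.* (n ∸ card n inA)) * ℕ→ℚ n
doubled-schurCount-all-≤ n inA col =
  subst₂ _≤_ (ℕ→ℚ-homo-+ F F)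
    (trans (ℕ→ℚ-homo-+ (2 ℕ.* S) (6 ℕ.* m ℕ.* n)) (cong (ℕ→ℚ (2 ℕ.* S) +_) (ℕ→ℚ-homo-* (6 ℕ.* m) n)))
    (ℕ→ℚ-mono-≤ (ℕP.≤-trans (ℕP.+-mono-≤ (schurCount-all-≤ n inA col) (schurCount-all-≤ n inA col))
                             (ℕP.≤-reflexive double)))
  where
  open +-*-Solver
  F S m : ℕ
  F = schurCount n (λ _ → true) col
  S = schurCount n inA col
  m = n ∸ card n inA
  double : S ℕ.+ 3 ℕ.* (n ℕ.* m) ℕ.+ (S ℕ.+ 3 ℕ.* (n ℕ.* m)) ≡ 2 ℕ.* S ℕ.+ 6 ℕ.* m ℕ.* n
  double = solve 3 (λ S n m → S :+ con 3 :* (n :* m) :+ (S :+ con 3 :* (n :* m))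
                              := con 2 :* S :+ con 6 :* m :* n) refl S n m

schurCount-transfer : (C : Real) (n : ℕ) (inA : ℕ → Bool) {k : ℕ} (col : ℕ → Fin k)
  → (∀ q → mem C q → q * ℕ→ℚ (n ℕ.* n) ≤ ℕ→ℚ (schurCount n (λ _ → true) col))
  → (∀ q → q * ℕ→ℚ n < ℕ→ℚ (6 ℕ.* (n ∸ card n inA)) → mem C q)
  → ∀ q → mem C q → q * ℕ→ℚ (n ℕ.* n) ≤ ℕ→ℚ (2 ℕ.* schurCount n inA col)
schurCount-transfer C zero    inA col full sparse q q∈C = ℚP.≤-reflexive (ℚP.*-zeroʳ q)
schurCount-transfer C (suc n) inA col full sparse =
  subst (λ M → ∀ q → mem C q → q * M ≤ ℕ→ℚ (2 ℕ.* schurCount (suc n) inA col)) (sym N*N)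
    (scaled-cut-bound C {{ℕ→ℚ-suc-pos n}} sparse
      (subst (λ M → ∀ r → mem C r → r * M ≤ ℕ→ℚ (schurCount (suc n) (λ _ → true) col)) N*N full)
      (doubled-schurCount-all-≤ (suc n) inA col))
  where
  N*N : ℕ→ℚ (suc n ℕ.* suc n) ≡ ℕ→ℚ (suc n) * ℕ→ℚ (suc n)
  N*N = ℕ→ℚ-homo-* (suc n) (suc n)

corollary2p1 : (k : ℕ) → k ≥ 1 → (C₁ : Real) → Positive C₁
  → (∃ λ N₀ → ∀ n → n ≥ N₀ → (col : ℕ → Fin k)
       → ∀ q → mem C₁ q → q * ℕ→ℚ (n Data.Nat.* n) ≤ ℕ→ℚ (schurCount n (λ _ → true) col))
  → ∃ λ N → ∀ n → n ≥ N → (inA : ℕ → Bool) → (col : ℕ → Fin k)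
       → (∀ q → q * ℕ→ℚ n < ℕ→ℚ (6 Data.Nat.* (n ∸ card n inA)) → mem C₁ q)
       → ∀ q → mem C₁ q → q * ℕ→ℚ (n Data.Nat.* n) ≤ ℕ→ℚ (2 Data.Nat.* schurCount n inA col)
corollary2p1 k _ C₁ _ (N₀ , full) =
  N₀ , λ n n≥N₀ inA col → schurCount-transfer C₁ n inA col (full n n≥N₀ col)
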